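{- Let $s\ge 2$ be an integer and let $d=p^r$ where $p\ge3$ is an odd prime and $r$ is a positive integer. Then there exist integers $s'=s'(s,d)$ and $d'=d'(s,d)$ with $1\le d'\le d$ such that for every positive integer $n$, $$\nu_d(f_n(s,-1))=\delta_{d'\mathbb{Z}}(n)\,\nu_d\!\left(\frac{s'n}{d'}\right).$$
   Context: For integers $s,t$, the generalized Fibonacci sequence is $f_0(s,t)=0$, $f_1(s,t)=1$, $f_n(s,t)=s f_{n-1}(s,t)+t f_{n-2}(s,t)$ for $n\ge2$. For $d=p^r$ and a nonzero rational $q$, $\nu_d(q)=\lfloor \nu_p(q)/r\rfloor$, where $\nu_p$ is the $p$-adic valuation; for a nonzero integer $N$ this is the largest $k$ with $d^k\mid N$. For a positive integer $d'$, $\delta_{d'\mathbb{Z}}(n)$ equals $1$ if $d'\mid n$ and $0$ otherwise. -}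

module Defs where

open import Data.Nat as ℕ using (ℕ; zero; suc)
open import Data.Nat.Divisibility using (_∣_; _∣?_; divides)
open import Data.Integer as ℤ using (ℤ; +_)
open import Data.Integer.DivMod using (_/ℕ_)
open import Data.Rational as ℚ using (ℚ; _/_)
open import Relation.Nullary using (yes; no)

fib : ℤ → ℤ → ℕ → ℤ
fib s t zero = + 0
fib s t (suc zero) = + 1
fib s t (suc (suc n)) = s ℤ.* fib s t (suc n) ℤ.+ t ℤ.* fib s t n

-- p-adic valuation of a natural number N (meaningful for N ≠ 0, p ≥ 2);
-- 'fuel' bounds the recursion; fuel = N suffices when p ≥ 2.
νℕ-fuel : ℕ → ℕ → ℕ → ℕ
νℕ-fuel zero p N = 0
νℕ-fuel (suc f) p zero = 0
νℕ-fuel (suc f) p N@(suc _) with p ∣? N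
... | yes (divides q _) = suc (νℕ-fuel f p q)
... | no _ = 0

νℕ : ℕ → ℕ → ℕ
νℕ p N = νℕ-fuel N p N

νp : ℕ → ℚ → ℤ
νp p q = + νℕ p ℤ.∣ ℚ.numerator q ∣ ℤ.- + νℕ p (ℚ.denominatorℕ q)

-- ν_d(q) = ⌊ ν_p(q) / r ⌋ for d = p^r (r ≥ 1; r = 0 is a junk case)
νd : ℕ → ℕ → ℚ → ℤ
νd p zero q = + 0
νd p (suc k) q = νp p q /ℕ suc k

δ : ℕ → ℕ → ℤ
δ d' n with d' ∣? n
... | yes _ = + 1
... | no _ = + 0

-- the rational a / b (b ≥ 1; b = 0 is a junk case)
ratio : ℤ → ℕ → ℚ
ratio a zero = ℚ.0ℚ
ratio a (suc k) = a / suc k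

module Submission where

-- For s ≥ 2 and an odd prime p write U n = f_n(s, -1).  Let ρ be the rank of apparition
-- of p (the least ρ ≥ 1 with p ∣ U ρ) and p^e ∥ U ρ.  We show ρ ≤ p and, for n ≥ 1,
--   ν_d(U n) = δ_{ρℤ}(n) · ν_d(p^e n / ρ),   d = p^r,
-- so the theorem holds with s' = p^e and d' = ρ.  Since ν_d only depends on ν_p, it is
-- enough to compare p-adic valuations:
--  * Lucas: the addition formula, d'Ocagne's and Cassini's identities, doubling.
--  * LucasModPrime.Rank: p ∣ U n iff ρ ∣ n (addition formula + Cassini).
--  * LucasModPrime.rank-exists: ρ ≤ p.  Otherwise the ratios U (n+2)/U (n+1) mod p,
--    n < p-1, are distinct nonzero residues (d'Ocagne), hence include 1 and -1; doubling
--    then gives two zeros U (2a+3), U (2b+3) below 2ρ, forcing a = b and 1 ≡ -1.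
--  * LucasModPrime.lifting (lifting the exponent): U (k m) = U m · G k where, when p ∣ U m,
--    G k ≡ k c^(k-1) (mod p) and G p ≡ p c^(p-1) (mod p²); so p^(e+b) ∥ U (p^b k ρ), p ∤ k.
--  * Valuation: ν_p(p^a w) = a for p ∤ w, also for integer-valued rationals.
-- Finally, if ρ ∤ n both sides are 0, and if n = p^b k ρ both have ν_p = e + b.

open import Defs
open import Data.Nat as ℕ using (ℕ; _≤_; _^_)
open import Data.Nat.Primality using (Prime)
open import Data.Integer as ℤ using (ℤ; +_; -[1+_])
open import Data.Rational as ℚ using (ℚ)
open import Data.Product using (Σ; _×_)
open import Relation.Binary.PropositionalEquality using (_≡_; _≢_)

open import Data.Nat using (zero; suc; z≤n; s≤s; _<_)
open import Data.Nat.Properties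
  using (≤-refl; ≤-trans; ≤-pred; <-trans; <-cmp; <⇒≢; <⇒≱; <⇒≤; ≮⇒≥; n<1+n; m<n⇒m<1+n;
         m<1+n⇒m<n∨m≡n; m≤m+n; m≤n+m; m≤n⇒∃[o]m+o≡n; suc-injective; suc-pred; _≟_; anyUpTo?;
         +-comm; +-suc; +-identityʳ; +-mono-<; +-mono-≤; +-monoʳ-≤;
         *-comm; *-assoc; *-identityˡ; *-zeroʳ; *-distribˡ-+; *-cancelʳ-≡; m<m*n;
         m*n≡0⇒m≡0∨n≡0; m*n≢0⇒m≢0; m^n≢0; m^n>0; ^-distribˡ-+-*; ^-identityʳ; ^-monoʳ-≤)
open import Data.Nat.Divisibility
  using (divides; ∣⇒≤; ∣-antisym; _∣0) renaming (_∣_ to _∣ℕ_; _∣?_ to _∣ℕ?_; ∣-refl to ∣ℕ-refl)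
open import Data.Nat.DivMod using (_%_; _/_; m≡m%n+[m/n]*n; m%n<n)
open import Data.Nat.GCD using (gcd; gcd[m,n]∣n; gcd-greatest; module Bézout)
open import Data.Nat.Coprimality using (Coprime; coprime-Bézout)
open import Data.Nat.Primality
  using (euclidsLemma; prime⇒irreducible; prime⇒nonZero; prime⇒nonTrivial)
open import Data.Nat.Combinatorics using (_C_; nC1≡n; nCk+nC[k+1]≡[n+1]C[k+1])
open import Data.Nat.Induction using (<-rec)
import Data.Nat.Tactic.RingSolver as ℕ-Ring
open import Data.Integer using (_+_; _*_; _-_; -_)
open import Data.Integer.Properties using (abs-*; pos-+; pos-*)
import Data.Integer.Properties as ZP
open import Data.Integer.Divisibility.Signed
  using (_∣_; _∣?_; divides; ∣ᵤ⇒∣; ∣⇒∣ᵤ; ∣-refl; ∣-trans; ∣m∣n⇒∣m+n; ∣m+n∣n⇒∣m; ∣m∣n⇒∣m-n;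
         ∣m⇒∣-m; ∣n⇒∣m*n; ∣m⇒∣m*n)
open import Data.Integer.DivMod using (_%ℕ_; _/ℕ_; a≡a%ℕn+[a/ℕn]*n; n%ℕd<d)
open import Data.Integer.Tactic.RingSolver using (solve-∀)
import Data.Rational.Properties as ℚP
open import Data.Fin as Fin using (Fin; toℕ; fromℕ<; punchOut)
open import Data.Fin.Properties using (pigeonhole; punchOut-injective; toℕ-fromℕ<; toℕ<n)
open import Data.Product using (_,_; ∃; ∃₂; proj₁; proj₂)
open import Data.Empty using (⊥; ⊥-elim)
open import Data.Sum using (_⊎_; inj₁; inj₂; [_,_]′)
open import Relation.Nullary using (¬_; yes; no)
open import Relation.Unary using (Decidable)
open import Relation.Binary.Definitions using (tri<; tri≈; tri>)
open import Relation.Binary.PropositionalEquality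
  using (refl; sym; trans; cong; cong₂; subst; subst₂; module ≡-Reasoning)

least-below : ∀ {ℓ} {P : ℕ → Set ℓ} → Decidable P → ∀ N → (∃ λ n → n < N × P n) →
              ∃ λ m → m < N × P m × (∀ {k} → k < m → ¬ P k)
least-below P? zero (_ , () , _)
least-below {P = P} P? (suc N) (n , n<1+N , Pn) with anyUpTo? P? N
... | yes earlier with least-below P? N earlier
...   | m , m<N , Pm , minimal = m , m<n⇒m<1+n m<N , Pm , minimal
least-below {P = P} P? (suc N) (n , n<1+N , Pn) | no none =
  N , n<1+n N , PN , λ k<N Pk → none (_ , k<N , Pk)
  where
  PN : P N
  PN with m<1+n⇒m<n∨m≡n n<1+N
  ... | inj₁ n<N = ⊥-elim (none (n , n<N , Pn))
  ... | inj₂ refl = Pn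

-- Pigeonhole principle, surjective form: an injective map from {0,…,m-1} into itself
-- is onto.  If y were missed, punching y out would squeeze m points into m-1 slots.
injective⇒onto : ∀ m (f : ℕ → ℕ) → (∀ {n} → n < m → f n < m) →
                 (∀ {i j} → i < j → j < m → f i ≢ f j) →
                 ∀ {y} → y < m → ∃ λ n → n < m × f n ≡ y
injective⇒onto zero f into injective ()
injective⇒onto (suc m) f into injective {y} y<m with anyUpTo? (λ n → f n ≟ y) (suc m)
... | yes hit = hit
... | no miss = ⊥-elim (collision (pigeonhole (n<1+n m) squeeze))
  where
  image : Fin (suc m) → Fin (suc m)
  image i = fromℕ< (into (toℕ<n i))

  image-toℕ : ∀ i → toℕ (image i) ≡ f (toℕ i)
  image-toℕ i = toℕ-fromℕ< (into (toℕ<n i))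

  y-missed : ∀ i → fromℕ< y<m ≢ image i
  y-missed i e = miss (toℕ i , toℕ<n i ,
    trans (sym (image-toℕ i)) (trans (cong toℕ (sym e)) (toℕ-fromℕ< y<m)))

  squeeze : Fin (suc m) → Fin m
  squeeze i = punchOut (y-missed i)

  collision : ∃₂ (λ i j → i Fin.< j × squeeze i ≡ squeeze j) → ⊥
  collision (i , j , i<j , e) = injective i<j (toℕ<n j)
    (trans (sym (image-toℕ i))
      (trans (cong toℕ (punchOut-injective (y-missed i) (y-missed j) e)) (image-toℕ j)))

multiple-below-double : ∀ {ρ x} → ρ ∣ℕ x → 1 ≤ x → x < ρ ℕ.+ ρ → x ≡ ρ
multiple-below-double (divides zero refl) () _
multiple-below-double {ρ} (divides (suc zero) refl) _ _ = +-identityʳ ρ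
multiple-below-double {ρ} (divides (suc (suc q)) refl) _ x<2ρ =
  ⊥-elim (<⇒≱ x<2ρ (+-monoʳ-≤ ρ (m≤m+n ρ (q ℕ.* ρ))))

double-bound : ∀ {x ρ0} → x ≤ ρ0 → suc (x ℕ.+ x) < suc ρ0 ℕ.+ suc ρ0
double-bound {x} {ρ0} x≤ρ0 =
  subst (suc (suc (x ℕ.+ x)) ≤_) (cong suc (sym (+-suc ρ0 ρ0))) (s≤s (s≤s (+-mono-≤ x≤ρ0 x≤ρ0)))

pred-< : ∀ {a b} → 0 < a → a < b → ℕ.pred a < ℕ.pred b
pred-< {suc a} {suc b} _ (s≤s a<b) = a<b

pred-injective : ∀ {a b} → 0 < a → 0 < b → ℕ.pred a ≡ ℕ.pred b → a ≡ b
pred-injective {suc a} {suc b} _ _ = cong suc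

positive-factor : ∀ {n q ρ} → n ≡ q ℕ.* ρ → 0 < n → 0 < q
positive-factor {q = zero} refl ()
positive-factor {q = suc q} _ _ = s≤s z≤n

positive-* : ∀ {a b} → 0 < a → 0 < b → 0 < a ℕ.* b
positive-* {suc a} {suc b} _ _ = s≤s z≤n

double-injective : ∀ {m n} → m ℕ.+ m ≡ n ℕ.+ n → m ≡ n
double-injective {m} {n} e with <-cmp m n
... | tri< m<n _ _ = ⊥-elim (<⇒≢ (+-mono-< m<n m<n) e)
... | tri≈ _ m≡n _ = m≡n
... | tri> _ _ n<m = ⊥-elim (<⇒≢ (+-mono-< n<m n<m) (sym e))

double-choose-two : ∀ n → 2 ℕ.* (suc n C 2) ≡ suc n ℕ.* n
double-choose-two zero = refl
double-choose-two (suc n) = begin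
  2 ℕ.* (suc (suc n) C 2)                 ≡⟨ cong (2 ℕ.*_) (sym (nCk+nC[k+1]≡[n+1]C[k+1] (suc n) 1)) ⟩
  2 ℕ.* (suc n C 1 ℕ.+ suc n C 2)         ≡⟨ cong (λ z → 2 ℕ.* (z ℕ.+ suc n C 2)) (nC1≡n (suc n)) ⟩
  2 ℕ.* (suc n ℕ.+ suc n C 2)             ≡⟨ *-distribˡ-+ 2 (suc n) (suc n C 2) ⟩
  2 ℕ.* suc n ℕ.+ 2 ℕ.* (suc n C 2)       ≡⟨ cong (2 ℕ.* suc n ℕ.+_) (double-choose-two n) ⟩
  2 ℕ.* suc n ℕ.+ suc n ℕ.* n             ≡⟨ expand n ⟩
  suc (suc n) ℕ.* suc n                   ∎
  where
  open ≡-Reasoning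
  expand : ∀ n → 2 ℕ.* suc n ℕ.+ suc n ℕ.* n ≡ suc (suc n) ℕ.* suc n
  expand = ℕ-Ring.solve-∀

odd-prime∣C[p,2] : ∀ {p} → Prime p → 3 ≤ p → p ∣ℕ p C 2
odd-prime∣C[p,2] {suc p′} p-prime 3≤p
  with euclidsLemma 2 (suc p′ C 2) p-prime (divides p′ (trans (double-choose-two p′) (*-comm (suc p′) p′)))
... | inj₂ p∣C = p∣C
... | inj₁ p∣2 = ⊥-elim (<⇒≱ 3≤p (∣⇒≤ p∣2))

module ModPrime (p : ℕ) (p-prime : Prime p) where

  P : ℤ
  P = + p

  instance
    p-nonZero : ℕ.NonZero p
    p-nonZero = prime⇒nonZero p-prime

  1<p : 1 < p
  1<p = ℕ.nonTrivial⇒n>1 p {{prime⇒nonTrivial p-prime}}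

  euclid : ∀ x y → P ∣ x * y → P ∣ x ⊎ P ∣ y
  euclid x y h with euclidsLemma ℤ.∣ x ∣ ℤ.∣ y ∣ p-prime (subst (p ∣ℕ_) (abs-* x y) (∣⇒∣ᵤ h))
  ... | inj₁ d = inj₁ (∣ᵤ⇒∣ d)
  ... | inj₂ d = inj₂ (∣ᵤ⇒∣ d)

  ∤-between : ∀ {n} → 0 < n → n < p → ¬ P ∣ + n
  ∤-between {suc n} _ n<p d = <⇒≱ n<p (∣⇒≤ (∣⇒∣ᵤ d))

  ∤-one : ¬ P ∣ + 1
  ∤-one = ∤-between (s≤s z≤n) 1<p

  ∤-* : ∀ {x y} → ¬ P ∣ x → ¬ P ∣ y → ¬ P ∣ x * y
  ∤-* {x} {y} p∤x p∤y d with euclid x y d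
  ... | inj₁ p∣x = p∤x p∣x
  ... | inj₂ p∣y = p∤y p∣y

  ∤-^ : ∀ {x} → ¬ P ∣ x → ∀ k → ¬ P ∣ x ℤ.^ k
  ∤-^ p∤x zero = ∤-one
  ∤-^ p∤x (suc k) = ∤-* p∤x (∤-^ p∤x k)

  ∤⇒positive : ∀ {k} → ¬ p ∣ℕ k → 0 < k
  ∤⇒positive {zero} p∤0 = ⊥-elim (p∤0 (p ∣0))
  ∤⇒positive {suc k} _ = s≤s z≤n

  inverseℕ : ∀ n → ¬ p ∣ℕ n → Σ ℤ λ z → P ∣ z * + n - + 1
  inverseℕ n p∤n with coprime-Bézout coprime
    where
    coprime : Coprime n p
    coprime (d∣n , d∣p) with prime⇒irreducible p-prime d∣p
    ... | inj₁ d≡1 = d≡1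
    ... | inj₂ refl = ⊥-elim (p∤n d∣n)
  ... | Bézout.+- a b eq = + a , divides (+ b) (begin
    + a * + n - + 1              ≡⟨ cong (_- + 1) (sym (pos-* a n)) ⟩
    + (a ℕ.* n) - + 1            ≡⟨ cong (λ z → + z - + 1) (sym eq) ⟩
    + (1 ℕ.+ b ℕ.* p) - + 1      ≡⟨ cong (_- + 1) (trans (pos-+ 1 (b ℕ.* p)) (cong (λ t → + 1 + t) (pos-* b p))) ⟩
    + 1 + + b * P - + 1          ≡⟨ cancel (+ b * P) ⟩
    + b * P                      ∎)
    where
    open ≡-Reasoning
    cancel : ∀ x → + 1 + x - + 1 ≡ x
    cancel = solve-∀
  ... | Bézout.-+ a b eq = - + a , divides (- + b) (begin
    - + a * + n - + 1            ≡⟨ negate (+ a) (+ n) ⟩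
    - (+ 1 + + a * + n)          ≡⟨ cong (λ z → - (+ 1 + z)) (sym (pos-* a n)) ⟩
    - (+ 1 + + (a ℕ.* n))        ≡⟨ cong -_ (sym (pos-+ 1 (a ℕ.* n))) ⟩
    - + (1 ℕ.+ a ℕ.* n)          ≡⟨ cong (λ z → - + z) eq ⟩
    - + (b ℕ.* p)                ≡⟨ cong -_ (pos-* b p) ⟩
    - (+ b * P)                  ≡⟨ ZP.neg-distribˡ-* (+ b) P ⟩
    - + b * P                    ∎)
    where
    open ≡-Reasoning
    negate : ∀ a n → - a * n - + 1 ≡ - (+ 1 + a * n)
    negate = solve-∀

  inverse : ∀ x → ¬ P ∣ x → Σ ℤ λ z → P ∣ z * x - + 1
  inverse (+ n) p∤x = inverseℕ n (λ d → p∤x (∣ᵤ⇒∣ d))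
  inverse -[1+ n ] p∤x with inverseℕ (suc n) (λ d → p∤x (∣ᵤ⇒∣ d))
  ... | z , d = - z , subst (P ∣_) (sign-flip z (+ suc n)) d
    where
    sign-flip : ∀ z x → z * x - + 1 ≡ - z * - x - + 1
    sign-flip = solve-∀

  residue-ratio : ∀ x y → ¬ P ∣ x → Σ ℕ λ τ → τ < p × P ∣ y - + τ * x
  residue-ratio x y p∤x with inverse x p∤x
  ... | z , p∣zx-1 = τ , n%ℕd<d (z * y) p ,
        subst (P ∣_) (sym y-τx) (∣m∣n⇒∣m+n (∣n⇒∣m*n (- y) p∣zx-1) (∣n⇒∣m*n (q * x) ∣-refl))
    where
    τ = (z * y) %ℕ p
    q = (z * y) /ℕ p
    y-τx : y - + τ * x ≡ - y * (z * x - + 1) + q * x * P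
    y-τx = begin
      y - + τ * x                   ≡⟨ cong (λ t → y - t * x) (isolate {z * y} {+ τ} {q * P} (a≡a%ℕn+[a/ℕn]*n (z * y) p)) ⟩
      y - (z * y - q * P) * x       ≡⟨ expand y z x q P ⟩
      - y * (z * x - + 1) + q * x * P ∎
      where
      open ≡-Reasoning
      isolate : ∀ {a t b} → a ≡ t + b → t ≡ a - b
      isolate {t = t} {b} refl = sym (cancelʳ t b)
        where
        cancelʳ : ∀ t b → t + b - b ≡ t
        cancelʳ = solve-∀
      expand : ∀ y z x q P → y - (z * y - q * P) * x ≡ - y * (z * x - + 1) + q * x * P
      expand = solve-∀

module Lucas (s : ℤ) where

  U : ℕ → ℤ
  U = fib s -[1+ 0 ]

  recurrence : ∀ n → U (suc (suc n)) ≡ s * U (suc n) - U n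
  recurrence n = cong (λ t → s * U (suc n) + t) (ZP.-1*i≡-i (U n))

  -- Addition formula U (m+j+1) = U (m+1) U (j+1) - U m U j: both sides satisfy the
  -- recurrence in m, so a two-step induction on m suffices.
  addition : ∀ m j → U (suc (m ℕ.+ j)) ≡ U (suc m) * U (suc j) - U m * U j
  addition zero j = base (U (suc j)) (U j)
    where
    base : ∀ a b → a ≡ + 1 * a - + 0 * b
    base = solve-∀
  addition (suc zero) j = trans (recurrence j) (base s (U (suc j)) (U j))
    where
    base : ∀ s a b → s * a - b ≡ (s * + 1 + -[1+ 0 ] * + 0) * a - + 1 * b
    base = solve-∀
  addition (suc (suc m)) j = begin
    U (suc (suc (suc (m ℕ.+ j))))
      ≡⟨ recurrence (suc (m ℕ.+ j)) ⟩
    s * U (suc (suc (m ℕ.+ j))) - U (suc (m ℕ.+ j))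
      ≡⟨ cong₂ (λ x y → s * x - y) (addition (suc m) j) (addition m j) ⟩
    s * (U (suc (suc m)) * a - U (suc m) * b) - (U (suc m) * a - U m * b)
      ≡⟨ regroup s (U (suc (suc m))) (U (suc m)) (U m) a b ⟩
    (s * U (suc (suc m)) - U (suc m)) * a - (s * U (suc m) - U m) * b
      ≡⟨ cong₂ (λ x y → x * a - y * b) (sym (recurrence (suc m))) (sym (recurrence m)) ⟩
    U (suc (suc (suc m))) * a - U (suc (suc m)) * b ∎
    where
    open ≡-Reasoning
    a = U (suc j)
    b = U j
    regroup : ∀ s x y z a b → s * (x * a - y * b) - (y * a - z * b) ≡ (s * x - y) * a - (s * y - z) * b
    regroup = solve-∀

  dOcagne : ∀ i k → U (suc i) * U (i ℕ.+ k) - U i * U (suc (i ℕ.+ k)) ≡ U k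
  dOcagne zero k = base (U k) (U (suc k))
    where
    base : ∀ a b → + 1 * a - + 0 * b ≡ a
    base = solve-∀
  dOcagne (suc i) k = begin
    U (suc (suc i)) * U (suc (i ℕ.+ k)) - U (suc i) * U (suc (suc (i ℕ.+ k)))
      ≡⟨ cong₂ (λ x y → x * U (suc (i ℕ.+ k)) - U (suc i) * y) (recurrence i) (recurrence (i ℕ.+ k)) ⟩
    (s * a - b) * c - a * (s * c - d)
      ≡⟨ cancel s a b c d ⟩
    a * d - b * c
      ≡⟨ dOcagne i k ⟩
    U k ∎
    where
    open ≡-Reasoning
    a = U (suc i)
    b = U i
    c = U (suc (i ℕ.+ k))
    d = U (i ℕ.+ k)
    cancel : ∀ s a b c d → (s * a - b) * c - a * (s * c - d) ≡ a * d - b * c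
    cancel = solve-∀

  cassini : ∀ n → U (suc n) * U (suc n) - U n * U (suc (suc n)) ≡ + 1
  cassini n = subst (λ m → U (suc n) * U m - U n * U (suc m) ≡ + 1)
                    (+-comm n 1) (dOcagne n 1)

  doubling : ∀ n → U (suc (n ℕ.+ n)) ≡ (U (suc n) - U n) * (U (suc n) + U n)
  doubling n = trans (addition n n) (factor (U (suc n)) (U n))
    where
    factor : ∀ a b → a * a - b * b ≡ (a - b) * (a + b)
    factor = solve-∀

-- For s = t + 2 the sequence increases strictly from U 0 = 0, so U (n+1) > 0.
module Positivity (t : ℕ) where
  open Lucas (+ suc (suc t))

  increasing : ∀ n → Σ ℕ λ a → Σ ℕ λ b → U n ≡ + a × U (suc n) ≡ + (a ℕ.+ suc b)
  increasing zero = 0 , 0 , refl , refl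
  increasing (suc n) with increasing n
  ... | a , b , Uₙ , Uₙ₊₁ = A , b ℕ.+ t ℕ.* A , Uₙ₊₁ , (begin
    U (suc (suc n))                       ≡⟨ recurrence n ⟩
    + suc (suc t) * U (suc n) - U n        ≡⟨ cong₂ (λ x y → + suc (suc t) * x - y) Uₙ₊₁ Uₙ ⟩
    + suc (suc t) * + A - + a              ≡⟨ cong (_- + a) (sym (pos-* (suc (suc t)) A)) ⟩
    + (suc (suc t) ℕ.* A) - + a            ≡⟨ cong (λ z → + z - + a) (split t a b) ⟩
    + (a ℕ.+ B) - + a                      ≡⟨ cong (_- + a) (pos-+ a B) ⟩
    + a + + B - + a                        ≡⟨ cancelˡ (+ a) (+ B) ⟩
    + B                                    ∎)
    where
    open ≡-Reasoning
    A = a ℕ.+ suc b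
    B = A ℕ.+ suc (b ℕ.+ t ℕ.* A)
    split : ∀ t a b → suc (suc t) ℕ.* (a ℕ.+ suc b)
                    ≡ a ℕ.+ ((a ℕ.+ suc b) ℕ.+ suc (b ℕ.+ t ℕ.* (a ℕ.+ suc b)))
    split = ℕ-Ring.solve-∀
    cancelˡ : ∀ x y → x + y - x ≡ y
    cancelˡ = solve-∀

  positive : ∀ n → Σ ℕ λ x → U (suc n) ≡ + suc x
  positive n with increasing n
  ... | a , b , _ , Uₙ₊₁ = a ℕ.+ b , trans Uₙ₊₁ (cong +_ (+-suc a b))

/-of-multiple : ∀ x y d → x ≡ y * + suc d →
                ℚ.numerator (x ℚ./ suc d) ≡ y × ℚ.denominatorℕ (x ℚ./ suc d) ≡ 1
/-of-multiple x y d x≡ = numerator≡ , ZP.+-injective denominator≡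
  where
  n = suc d
  gcd≡n : gcd ℤ.∣ x ∣ n ≡ n
  gcd≡n = ∣-antisym (gcd[m,n]∣n ℤ.∣ x ∣ n)
            (gcd-greatest (divides ℤ.∣ y ∣ (trans (cong ℤ.∣_∣ x≡) (abs-* y (+ n)))) ∣ℕ-refl)
  numerator≡ : ℚ.numerator (x ℚ./ n) ≡ y
  numerator≡ = ZP.*-cancelʳ-≡ _ y (+ n)
    (trans (cong (λ g → ℚ.numerator (x ℚ./ n) * + g) (sym gcd≡n)) (trans (ℚP.↥-/ x n) x≡))
  denominator≡ : ℚ.denominator (x ℚ./ n) ≡ + 1
  denominator≡ = ZP.*-cancelʳ-≡ _ (+ 1) (+ n)
    (trans (cong (λ g → ℚ.denominator (x ℚ./ n) * + g) (sym gcd≡n))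
           (trans (ℚP.↧-/ x n) (sym (ZP.*-identityˡ (+ n)))))

νd-congruent : ∀ p r {q q′} → νp p q ≡ νp p q′ → νd p r q ≡ νd p r q′
νd-congruent p zero _ = refl
νd-congruent p (suc r) e = cong (_/ℕ suc r) e

νd-zero : ∀ p r {q} → νp p q ≡ + 0 → νd p r q ≡ + 0
νd-zero p zero _ = refl
νd-zero p (suc r) e = cong (_/ℕ suc r) e

module Valuation (p : ℕ) (p-prime : Prime p) where
  open ModPrime p p-prime

  νℕ-fuel-∣ : ∀ f N q → suc N ≡ q ℕ.* p → νℕ-fuel (suc f) p (suc N) ≡ suc (νℕ-fuel f p q)
  νℕ-fuel-∣ f N q eq with p ∣ℕ? suc N
  ... | yes (divides q′ eq′) = cong (λ z → suc (νℕ-fuel f p z)) (*-cancelʳ-≡ q′ q p (trans (sym eq′) eq))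
  ... | no p∤ = ⊥-elim (p∤ (divides q eq))

  νℕ-fuel-∤ : ∀ f N → ¬ p ∣ℕ suc N → νℕ-fuel (suc f) p (suc N) ≡ 0
  νℕ-fuel-∤ f N p∤ with p ∣ℕ? suc N
  ... | yes d = ⊥-elim (p∤ d)
  ... | no _ = refl

  νℕ-fuel-exact : ∀ a w f N → ¬ p ∣ℕ w → N ≡ p ^ a ℕ.* w → N ≤ f → νℕ-fuel f p N ≡ a
  νℕ-fuel-exact a w f zero p∤w N≡ _ with m*n≡0⇒m≡0∨n≡0 (p ^ a) (sym N≡)
  ... | inj₁ pᵃ≡0 = ⊥-elim (ℕ.≢-nonZero⁻¹ (p ^ a) {{m^n≢0 p a}} pᵃ≡0)
  ... | inj₂ refl = ⊥-elim (p∤w (divides 0 refl))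
  νℕ-fuel-exact zero w (suc f) (suc N) p∤w N≡ _ =
    νℕ-fuel-∤ f N (λ d → p∤w (subst (p ∣ℕ_) (trans N≡ (*-identityˡ w)) d))
  νℕ-fuel-exact (suc a) w (suc f) (suc N) p∤w N≡ (s≤s N≤f) =
    trans (νℕ-fuel-∣ f N M N≡Mp) (cong suc (νℕ-fuel-exact a w f M p∤w refl (≤-trans M≤N N≤f)))
    where
    M = p ^ a ℕ.* w
    N≡Mp : suc N ≡ M ℕ.* p
    N≡Mp = trans N≡ (trans (*-assoc p (p ^ a) w) (*-comm p M))
    M≤N : M ≤ N
    M≤N = ≤-pred (subst (M <_) (sym N≡Mp)
            (m<m*n M p {{m*n≢0⇒m≢0 M {{subst ℕ.NonZero N≡Mp _}}}} 1<p))
  νℕ-fuel-exact a w zero (suc N) p∤w N≡ ()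

  νℕ-exact : ∀ a w → ¬ p ∣ℕ w → νℕ p (p ^ a ℕ.* w) ≡ a
  νℕ-exact a w p∤w = νℕ-fuel-exact a w _ _ p∤w refl ≤-refl

  p-adic : ∀ n → 0 < n → Σ ℕ λ a → Σ ℕ λ w → n ≡ p ^ a ℕ.* w × ¬ p ∣ℕ w
  p-adic = <-rec _ split
    where
    split : ∀ n → (∀ {m} → m < n → 0 < m → Σ ℕ λ a → Σ ℕ λ w → m ≡ p ^ a ℕ.* w × ¬ p ∣ℕ w) →
            0 < n → Σ ℕ λ a → Σ ℕ λ w → n ≡ p ^ a ℕ.* w × ¬ p ∣ℕ w
    split n rec 0<n with p ∣ℕ? n
    ... | no p∤n = 0 , n , sym (*-identityˡ n) , p∤n
    ... | yes (divides q n≡qp) with rec q<n 0<q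
      where
      instance
        _ : ℕ.NonZero q
        _ = m*n≢0⇒m≢0 q {{subst ℕ.NonZero n≡qp (ℕ.>-nonZero 0<n)}}
      0<q : 0 < q
      0<q = ℕ.>-nonZero⁻¹ q
      q<n : q < n
      q<n = subst (q <_) (sym n≡qp) (m<m*n q p 1<p)
    ...   | a , w , q≡ , p∤w = suc a , w , n≡ , p∤w
      where
      n≡ : n ≡ p ^ suc a ℕ.* w
      n≡ = trans n≡qp (trans (cong (ℕ._* p) q≡) (regroup p (p ^ a) w))
        where
        regroup : ∀ p x w → x ℕ.* w ℕ.* p ≡ p ℕ.* x ℕ.* w
        regroup = ℕ-Ring.solve-∀

  record Exact (a : ℕ) (x : ℤ) : Set where
    constructor exactly
    field
      cofactor : ℤ
      p∤cofactor : ¬ P ∣ cofactor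
      x≡pᵃw : x ≡ + (p ^ a) * cofactor

  exact-unit : ∀ {x} → ¬ P ∣ x → Exact 0 x
  exact-unit {x} p∤x = exactly x p∤x (sym (ZP.*-identityˡ x))

  exact-* : ∀ {a b x y} → Exact a x → Exact b y → Exact (a ℕ.+ b) (x * y)
  exact-* {a} {b} (exactly w p∤w refl) (exactly w′ p∤w′ refl) = exactly (w * w′) (∤-* p∤w p∤w′) (begin
    + (p ^ a) * w * (+ (p ^ b) * w′)       ≡⟨ regroup (+ (p ^ a)) w (+ (p ^ b)) w′ ⟩
    + (p ^ a) * + (p ^ b) * (w * w′)       ≡⟨ cong (_* (w * w′)) (sym (pos-* (p ^ a) (p ^ b))) ⟩
    + (p ^ a ℕ.* p ^ b) * (w * w′)         ≡⟨ cong (λ z → + z * (w * w′)) (sym (^-distribˡ-+-* p a b)) ⟩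
    + (p ^ (a ℕ.+ b)) * (w * w′)           ∎)
    where
    open ≡-Reasoning
    regroup : ∀ x w y w′ → x * w * (y * w′) ≡ x * y * (w * w′)
    regroup = solve-∀

  exact-ℕ : ∀ {n a w} → n ≡ p ^ a ℕ.* w → ¬ p ∣ℕ w → Exact a (+ n)
  exact-ℕ {a = a} {w} refl p∤w = exactly (+ w) (λ d → p∤w (∣⇒∣ᵤ d)) (pos-* (p ^ a) w)

  exact-of-positive : ∀ {x} → (Σ ℕ λ n → x ≡ + suc n) → ∃ λ a → Exact a x
  exact-of-positive (n , refl) with p-adic (suc n) (s≤s z≤n)
  ... | a , w , eq , p∤w = a , exact-ℕ eq p∤w

  νℕ-of-exact : ∀ {a x} → Exact a x → νℕ p ℤ.∣ x ∣ ≡ a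
  νℕ-of-exact {a} (exactly w p∤w refl) =
    trans (cong (νℕ p) (abs-* (+ (p ^ a)) w)) (νℕ-exact a ℤ.∣ w ∣ (λ d → p∤w (∣ᵤ⇒∣ d)))

  νp-integer : ∀ {x y d a} → x ≡ y * + suc d → Exact a y → νp p (ratio x (suc d)) ≡ + a
  νp-integer {x} {y} {d} {a} x≡ y-exact with /-of-multiple x y d x≡
  ... | num≡ , den≡ = begin
    + νℕ p ℤ.∣ ℚ.numerator q ∣ - + νℕ p (ℚ.denominatorℕ q)
      ≡⟨ cong₂ (λ u v → + νℕ p ℤ.∣ u ∣ - + νℕ p v) num≡ den≡ ⟩
    + νℕ p ℤ.∣ y ∣ - + νℕ p 1
      ≡⟨ cong₂ (λ u v → + u - + v) (νℕ-of-exact y-exact) (νℕ-exact 0 1 (λ d → ∤-one (∣ᵤ⇒∣ d))) ⟩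
    + a - + 0
      ≡⟨ ZP.+-identityʳ (+ a) ⟩
    + a ∎
    where
    open ≡-Reasoning
    q = ratio x (suc d)

module LucasModPrime (s : ℤ) (p : ℕ) (p-prime : Prime p) where
  open Lucas s
  open ModPrime p p-prime
  open Valuation p p-prime

  consecutive : ∀ n → P ∣ U n → ¬ P ∣ U (suc n)
  consecutive n p∣Uₙ p∣Uₙ₊₁ = ∤-one (subst (P ∣_) (cassini n)
    (∣m∣n⇒∣m-n (∣n⇒∣m*n (U (suc n)) p∣Uₙ₊₁) (∣m⇒∣m*n (U (suc (suc n))) p∣Uₙ)))

  common-ratio : ∀ i k τ → P ∣ U (suc i) - τ * U i → P ∣ U (suc (i ℕ.+ k)) - τ * U (i ℕ.+ k) → P ∣ U k
  common-ratio i k τ d₁ d₂ =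
    subst (P ∣_) (trans (eliminate (U (suc i)) (U i) (U (i ℕ.+ k)) (U (suc (i ℕ.+ k))) τ) (dOcagne i k))
      (∣m∣n⇒∣m-n (∣m⇒∣m*n (U (i ℕ.+ k)) d₁) (∣n⇒∣m*n (U i) d₂))
    where
    eliminate : ∀ a b c d τ → (a - τ * b) * c - b * (d - τ * c) ≡ a * c - b * d
    eliminate = solve-∀

  -- Along the multiples of m = m0 + 1.  With u = U m, c = -U m0 and a = U (m+1),
  -- U (k m) = u · G k and U (k m + 1) = Z k for the sequences G, Z below.
  module Multiples (m0 : ℕ) where
    m : ℕ
    m = suc m0

    u c a : ℤ
    u = U m
    c = - U m0
    a = U (suc m)

    G Z : ℕ → ℤ
    G zero = + 0
    G (suc k) = c * G k + Z k
    Z zero = + 1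
    Z (suc k) = a * Z k - u * u * G k

    factorisation : ∀ k → U (k ℕ.* m) ≡ u * G k × U (suc (k ℕ.* m)) ≡ Z k
    factorisation zero = sym (ZP.*-zeroʳ u) , refl
    factorisation (suc k) with factorisation k
    ... | Uₖₘ , Uₖₘ₊₁ =
      trans (addition m0 (k ℕ.* m)) (trans (cong₂ (λ z g → u * z - U m0 * g) Uₖₘ₊₁ Uₖₘ) (regroup₁ u (U m0) (G k) (Z k))) ,
      trans (addition m (k ℕ.* m)) (trans (cong₂ (λ z g → a * z - u * g) Uₖₘ₊₁ Uₖₘ) (regroup₂ u a (G k) (Z k)))
      where
      regroup₁ : ∀ u b g z → u * z - b * (u * g) ≡ u * (- b * g + z)
      regroup₁ = solve-∀
      regroup₂ : ∀ u a g z → a * z - u * (u * g) ≡ a * z - u * u * g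
      regroup₂ = solve-∀

    a≡c+su : a ≡ c + s * u
    a≡c+su = trans (recurrence m0) (swap s u (U m0))
      where
      swap : ∀ s u b → s * u - b ≡ - b + s * u
      swap = solve-∀

    -- K k = k c^(k-1) and H k = C(k,2) c^(k-2): the first two coefficients of
    -- Z and G as polynomials in u.
    K H : ℕ → ℤ
    K k = + k * c ℤ.^ (k ℕ.∸ 1)
    H k = + (k C 2) * c ℤ.^ (k ℕ.∸ 2)

    K-step : ∀ k → K (suc k) ≡ c * K k + c ℤ.^ k
    K-step zero = base c
      where
      base : ∀ c → + 1 * + 1 ≡ c * + 0 + + 1
      base = solve-∀
    K-step (suc k) = step c (c ℤ.^ k) (+ suc k)
      where
      step : ∀ c x n → (+ 1 + n) * (c * x) ≡ c * (n * x) + c * x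
      step = solve-∀

    H-step : ∀ k → H (suc k) ≡ c * H k + K k
    H-step zero = base c
      where
      base : ∀ c → + 0 ≡ c * + 0 + + 0
      base = solve-∀
    H-step (suc zero) = base c
      where
      base : ∀ c → + 1 * + 1 ≡ c * + 0 + + 1 * + 1
      base = solve-∀
    H-step (suc (suc k)) = begin
      + (suc (suc (suc k)) C 2) * (c * x)
        ≡⟨ cong (λ z → + z * (c * x)) (sym (nCk+nC[k+1]≡[n+1]C[k+1] (suc (suc k)) 1)) ⟩
      + (suc (suc k) C 1 ℕ.+ suc (suc k) C 2) * (c * x)
        ≡⟨ cong (λ z → + (z ℕ.+ suc (suc k) C 2) * (c * x)) (nC1≡n (suc (suc k))) ⟩
      + (suc (suc k) ℕ.+ suc (suc k) C 2) * (c * x)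
        ≡⟨ cong (_* (c * x)) (pos-+ (suc (suc k)) (suc (suc k) C 2)) ⟩
      (+ suc (suc k) + + (suc (suc k) C 2)) * (c * x)
        ≡⟨ step c x (+ suc (suc k)) (+ (suc (suc k) C 2)) ⟩
      c * (+ (suc (suc k) C 2) * x) + + suc (suc k) * (c * x) ∎
      where
      open ≡-Reasoning
      x = c ℤ.^ k
      step : ∀ c x n b → (n + b) * (c * x) ≡ c * (b * x) + n * (c * x)
      step = solve-∀

    expansion : ∀ k → u * u ∣ Z k - (c ℤ.^ k + s * u * K k) × u * u ∣ G k - (K k + s * u * H k)
    expansion zero = divides (+ 0) (base₁ s u) , divides (+ 0) (base₂ s u)
      where
      base₁ : ∀ s u → + 1 - (+ 1 + s * u * + 0) ≡ + 0 * (u * u)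
      base₁ = solve-∀
      base₂ : ∀ s u → + 0 - (+ 0 + s * u * + 0) ≡ + 0 * (u * u)
      base₂ = solve-∀
    expansion (suc k) with expansion k
    ... | Z-close , G-close =
      subst (u * u ∣_) (sym Z-step)
        (∣m∣n⇒∣m+n (∣n⇒∣m*n a Z-close) (∣m⇒∣m*n (s * s * K k - G k) ∣-refl)) ,
      subst (u * u ∣_) (sym G-step) (∣m∣n⇒∣m+n (∣n⇒∣m*n c G-close) Z-close)
      where
      open ≡-Reasoning
      cᵏ = c ℤ.^ k
      Z-step : Z (suc k) - (c ℤ.^ suc k + s * u * K (suc k))
             ≡ a * (Z k - (cᵏ + s * u * K k)) + u * u * (s * s * K k - G k)
      Z-step = begin
        a * Z k - u * u * G k - (c * cᵏ + s * u * K (suc k))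
          ≡⟨ cong (λ t → a * Z k - u * u * G k - (c * cᵏ + s * u * t)) (K-step k) ⟩
        a * Z k - u * u * G k - (c * cᵏ + s * u * (c * K k + cᵏ))
          ≡⟨ cong (λ t → t * Z k - u * u * G k - (c * cᵏ + s * u * (c * K k + cᵏ))) a≡c+su ⟩
        (c + s * u) * Z k - u * u * G k - (c * cᵏ + s * u * (c * K k + cᵏ))
          ≡⟨ rearrange c s u (Z k) (G k) cᵏ (K k) ⟩
        (c + s * u) * (Z k - (cᵏ + s * u * K k)) + u * u * (s * s * K k - G k)
          ≡⟨ cong (λ t → t * (Z k - (cᵏ + s * u * K k)) + u * u * (s * s * K k - G k)) (sym a≡c+su) ⟩
        a * (Z k - (cᵏ + s * u * K k)) + u * u * (s * s * K k - G k) ∎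
        where
        rearrange : ∀ c s u Z G cᵏ K → (c + s * u) * Z - u * u * G - (c * cᵏ + s * u * (c * K + cᵏ))
                  ≡ (c + s * u) * (Z - (cᵏ + s * u * K)) + u * u * (s * s * K - G)
        rearrange = solve-∀
      G-step : G (suc k) - (K (suc k) + s * u * H (suc k))
             ≡ c * (G k - (K k + s * u * H k)) + (Z k - (cᵏ + s * u * K k))
      G-step = begin
        c * G k + Z k - (K (suc k) + s * u * H (suc k))
          ≡⟨ cong₂ (λ t h → c * G k + Z k - (t + s * u * h)) (K-step k) (H-step k) ⟩
        c * G k + Z k - ((c * K k + cᵏ) + s * u * (c * H k + K k))
          ≡⟨ rearrange c s u (Z k) (G k) cᵏ (K k) (H k) ⟩
        c * (G k - (K k + s * u * H k)) + (Z k - (cᵏ + s * u * K k)) ∎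
        where
        rearrange : ∀ c s u Z G cᵏ K H → c * G + Z - ((c * K + cᵏ) + s * u * (c * H + K))
                  ≡ c * (G - (K + s * u * H)) + (Z - (cᵏ + s * u * K))
        rearrange = solve-∀

    module _ (p∣u : P ∣ u) where

      -- c is a unit modulo p, since Cassini gives u² - U m0 · a = 1.
      c-unit : ¬ P ∣ c
      c-unit p∣c = ∤-one (subst (P ∣_) (cassini m0) (∣m∣n⇒∣m-n (∣m⇒∣m*n u p∣u) (∣m⇒∣m*n a p∣Um0)))
        where
        p∣Um0 : P ∣ U m0
        p∣Um0 = subst (P ∣_) (ZP.neg-involutive (U m0)) (∣m⇒∣-m p∣c)

      private
        p∣u² : P ∣ u * u
        p∣u² = ∣-trans p∣u (∣n⇒∣m*n u (∣-refl {u}))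

      -- G k ≡ K k = k c^(k-1) (mod p), so p ∤ G k when p ∤ k.
      G-unit : ∀ k → ¬ p ∣ℕ k → ¬ P ∣ G k
      G-unit k p∤k p∣G =
        [ (λ p∣k → p∤k (∣⇒∣ᵤ p∣k)) , ∤-^ c-unit (k ℕ.∸ 1) ]′ (euclid (+ k) (c ℤ.^ (k ℕ.∸ 1)) p∣K)
        where
        p∣K : P ∣ K k
        p∣K = subst (P ∣_) (solve-K (G k) (K k) s u (H k))
          (∣m∣n⇒∣m-n (∣m∣n⇒∣m-n p∣G (∣-trans p∣u² (proj₂ (expansion k))))
                      (∣m⇒∣m*n (H k) (∣n⇒∣m*n s p∣u)))
          where
          solve-K : ∀ G K s u H → G - (G - (K + s * u * H)) - s * u * H ≡ K
          solve-K = solve-∀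

      -- G p ≡ p c^(p-1) (mod p²) when p ∣ C(p,2), so p exactly divides G p.
      G-at-p : p ∣ℕ p C 2 → Exact 1 (G p)
      G-at-p (divides t pC2≡) = exactly g p∤g (begin
        G p
          ≡⟨ decompose (G p) (K p) (s * u * H p) ⟩
        (G p - (K p + s * u * H p)) + K p + s * u * H p
          ≡⟨ cong₂ (λ x y → x + K p + s * y * (+ (p C 2) * c ℤ.^ (p ℕ.∸ 2))) G-close u≡ ⟩
        e * (u * u) + K p + s * (v * P) * (+ (p C 2) * c ℤ.^ (p ℕ.∸ 2))
          ≡⟨ cong₂ (λ x y → e * (x * x) + K p + s * (v * P) * (y * c ℤ.^ (p ℕ.∸ 2))) u≡
                   (trans (cong +_ pC2≡) (pos-* t p)) ⟩
        e * ((v * P) * (v * P)) + + p * c ℤ.^ (p ℕ.∸ 1) + s * (v * P) * ((+ t * P) * c ℤ.^ (p ℕ.∸ 2))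
          ≡⟨ factor-p e v P s (+ t) (c ℤ.^ (p ℕ.∸ 1)) (c ℤ.^ (p ℕ.∸ 2)) ⟩
        P * g
          ≡⟨ cong (λ q → + q * g) (sym (^-identityʳ p)) ⟩
        + (p ^ 1) * g ∎)
        where
        e = _∣_.quotient (proj₂ (expansion p))
        G-close = _∣_.equality (proj₂ (expansion p))
        v = _∣_.quotient p∣u
        u≡ = _∣_.equality p∣u
        open ≡-Reasoning
        rest = s * v * + t * c ℤ.^ (p ℕ.∸ 2) + e * v * v
        g = c ℤ.^ (p ℕ.∸ 1) + P * rest
        p∤g : ¬ P ∣ g
        p∤g p∣g = ∤-^ c-unit (p ℕ.∸ 1)
          (subst (P ∣_) (cancel (c ℤ.^ (p ℕ.∸ 1)) (P * rest)) (∣m∣n⇒∣m-n p∣g (∣m⇒∣m*n rest ∣-refl)))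
          where
          cancel : ∀ x y → x + y - y ≡ x
          cancel = solve-∀
        decompose : ∀ x k h → x ≡ (x - (k + h)) + k + h
        decompose = solve-∀
        factor-p : ∀ e v P s t x y → e * ((v * P) * (v * P)) + P * x + s * (v * P) * ((t * P) * y)
                 ≡ P * (x + P * (s * v * t * y + e * v * v))
        factor-p = solve-∀

  vanishes-on-multiples : ∀ {M} k → P ∣ U M → P ∣ U (k ℕ.* M)
  vanishes-on-multiples {zero} k _ = subst (λ n → P ∣ U n) (sym (*-zeroʳ k)) (divides (+ 0) refl)
  vanishes-on-multiples {suc m0} k p∣u =
    subst (P ∣_) (sym (proj₁ (factorisation k))) (∣m⇒∣m*n (G k) p∣u)
    where open Multiples m0

  lift-coprime : ∀ {M e k} → 0 < M → P ∣ U M → Exact e (U M) → ¬ p ∣ℕ k → Exact e (U (k ℕ.* M))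
  lift-coprime {suc m0} {e} {k} _ p∣u u-exact p∤k =
    subst₂ Exact (+-identityʳ e) (sym (proj₁ (factorisation k)))
      (exact-* u-exact (exact-unit (G-unit p∣u k p∤k)))
    where open Multiples m0

  lift-p : ∀ {M e} → 0 < M → p ∣ℕ p C 2 → P ∣ U M → Exact e (U M) → Exact (suc e) (U (p ℕ.* M))
  lift-p {suc m0} {e} _ p∣C p∣u u-exact =
    subst₂ Exact (+-comm e 1) (sym (proj₁ (factorisation p))) (exact-* u-exact (G-at-p p∣u p∣C))
    where open Multiples m0

  lifting : ∀ {M e} → 0 < M → p ∣ℕ p C 2 → P ∣ U M → Exact e (U M) →
            ∀ b k → ¬ p ∣ℕ k → Exact (e ℕ.+ b) (U (p ^ b ℕ.* k ℕ.* M))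
  lifting {M} {e} 0<M _ p∣u u-exact zero k p∤k =
    subst₂ Exact (sym (+-identityʳ e)) (cong (λ j → U (j ℕ.* M)) (sym (*-identityˡ k)))
      (lift-coprime 0<M p∣u u-exact p∤k)
  lifting {M} {e} 0<M p∣C p∣u u-exact (suc b) k p∤k =
    subst₂ Exact (sym (+-suc e b)) (cong U (regroup p (p ^ b) k M))
      (lift-p 0<M′ p∣C (vanishes-on-multiples (p ^ b ℕ.* k) p∣u) (lifting 0<M p∣C p∣u u-exact b k p∤k))
    where
    0<M′ : 0 < p ^ b ℕ.* k ℕ.* M
    0<M′ = positive-* (positive-* (m^n>0 p b) (∤⇒positive p∤k)) 0<M
    regroup : ∀ p x k M → p ℕ.* (x ℕ.* k ℕ.* M) ≡ p ℕ.* x ℕ.* k ℕ.* M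
    regroup = ℕ-Ring.solve-∀

  FirstZero : ℕ → Set
  FirstZero ρ0 = P ∣ U (suc ρ0) × (∀ {k} → k < ρ0 → ¬ P ∣ U (suc k))

  module Rank (ρ0 : ℕ) (first : FirstZero ρ0) where
    ρ : ℕ
    ρ = suc ρ0

    rank-divides : ∀ n → P ∣ U n → ρ ∣ℕ n
    rank-divides n p∣Uₙ = by-remainder (n % ρ) (n / ρ) (m≡m%n+[m/n]*n n ρ) (m%n<n n ρ)
      where
      -- Writing n = (r0+1) + qρ, the addition formula gives
      -- U n ≡ U (r0+1) U (qρ+1) (mod p), and neither factor is divisible by p.
      by-remainder : ∀ r q → n ≡ r ℕ.+ q ℕ.* ρ → r < ρ → ρ ∣ℕ n
      by-remainder zero q n≡ _ = divides q n≡
      by-remainder (suc r0) q n≡ (s≤s r0<ρ0) =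
        ⊥-elim ([ proj₂ first r0<ρ0 , consecutive (q ℕ.* ρ) p∣Uqρ ]′ (euclid (U (suc r0)) (U (suc (q ℕ.* ρ))) p∣product))
        where
        p∣Uqρ : P ∣ U (q ℕ.* ρ)
        p∣Uqρ = vanishes-on-multiples q (proj₁ first)
        p∣product : P ∣ U (suc r0) * U (suc (q ℕ.* ρ))
        p∣product = ∣m+n∣n⇒∣m
          (subst (P ∣_) (addition r0 (q ℕ.* ρ)) (subst (λ k → P ∣ U k) n≡ p∣Uₙ))
          (∣m⇒∣-m (∣n⇒∣m*n (U r0) p∣Uqρ))

  τ : ℕ → ℕ
  τ n with P ∣? U (suc n)
  ... | yes _ = 0
  ... | no p∤ = proj₁ (residue-ratio (U (suc n)) (U (suc (suc n))) p∤)

  τ-spec : ∀ n → ¬ P ∣ U (suc n) → τ n < p × P ∣ U (suc (suc n)) - + τ n * U (suc n)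
  τ-spec n p∤ with P ∣? U (suc n)
  ... | yes p∣ = ⊥-elim (p∤ p∣)
  ... | no p∤′ = proj₂ (residue-ratio (U (suc n)) (U (suc (suc n))) p∤′)

  -- For odd p, some U n with 1 ≤ n ≤ p is divisible by p.  Otherwise the ratios
  -- τ 0, …, τ (p-2) are p-1 distinct nonzero residues, so two of them are 1 and -1.
  -- Then p ∣ U (2a+3) and p ∣ U (2b+3) by doubling, and both indices lie below
  -- twice the rank, hence coincide; but then 1 ≡ -1 (mod p).
  module WithoutEarlyZero (p-odd : 3 ≤ p) (no-zero : ∀ {n} → n < p → ¬ P ∣ U (suc n)) where

    m : ℕ
    m = ℕ.pred p

    -- Indices n < m = p - 1 have n + 2 ≤ p, so U (n+1) and U (n+2) are prime to p.
    n<m⇒suc-n<p : ∀ {n} → n < m → suc n < p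
    n<m⇒suc-n<p {n} n<m = subst (suc (suc n) ≤_) (suc-pred p) (s≤s n<m)

    τ-ok : ∀ {n} → n < m → τ n < p × P ∣ U (suc (suc n)) - + τ n * U (suc n)
    τ-ok n<m = τ-spec _ (no-zero (<-trans (n<1+n _) (n<m⇒suc-n<p n<m)))

    -- τ n ≠ 0, since p ∤ U (n+2).
    τ-positive : ∀ {n} → n < m → 0 < τ n
    τ-positive {n} n<m with τ n | τ-ok n<m
    ... | zero | _ , p∣ = ⊥-elim (no-zero (n<m⇒suc-n<p n<m) (subst (P ∣_) (drop-zero (U (suc (suc n))) (U (suc n))) p∣))
      where
      drop-zero : ∀ x y → x - + 0 * y ≡ x
      drop-zero = solve-∀
    ... | suc _ | _ = s≤s z≤n

    -- Equal ratios at i < j would give p ∣ U (j - i) with 0 < j - i < p.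
    τ-injective : ∀ {i j} → i < j → j < m → τ i ≢ τ j
    τ-injective {i} {j} i<j j<m τᵢ≡τⱼ with m≤n⇒∃[o]m+o≡n i<j
    ... | o , i+1+o≡j = no-zero o<p (common-ratio (suc i) (suc o) (+ τ i) (proj₂ (τ-ok i<m)) p∣ⱼ)
      where
      i<m : i < m
      i<m = <-trans i<j j<m
      i+1+o+1≡j+1 : suc i ℕ.+ suc o ≡ suc j
      i+1+o+1≡j+1 = trans (+-suc (suc i) o) (cong suc i+1+o≡j)
      p∣ⱼ : P ∣ U (suc (suc i ℕ.+ suc o)) - + τ i * U (suc i ℕ.+ suc o)
      p∣ⱼ = subst (λ k → P ∣ U (suc k) - + τ i * U k) (sym i+1+o+1≡j+1)
              (subst (λ t → P ∣ U (suc (suc j)) - + t * U (suc j)) (sym τᵢ≡τⱼ) (proj₂ (τ-ok j<m)))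
      o<p : o < p
      o<p = ≤-trans (s≤s (subst (o ≤_) i+1+o≡j (m≤n+m o (suc i))))
                    (<⇒≤ (n<m⇒suc-n<p j<m))

    τ-onto : ∀ {y} → 0 < y → y < p → ∃ λ n → n < m × τ n ≡ y
    τ-onto {y} 0<y y<p = unshift (injective⇒onto m (λ n → ℕ.pred (τ n)) into injective (pred-< 0<y y<p))
      where
      into : ∀ {n} → n < m → ℕ.pred (τ n) < m
      into n<m = pred-< (τ-positive n<m) (proj₁ (τ-ok n<m))
      injective : ∀ {i j} → i < j → j < m → ℕ.pred (τ i) ≢ ℕ.pred (τ j)
      injective i<j j<m e =
        τ-injective i<j j<m (pred-injective (τ-positive (<-trans i<j j<m)) (τ-positive j<m) e)
      unshift : (∃ λ n → n < m × ℕ.pred (τ n) ≡ ℕ.pred y) → ∃ λ n → n < m × τ n ≡ y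
      unshift (n , n<m , e) = n , n<m , pred-injective (τ-positive n<m) 0<y e

    ratio-one : ∃ λ a → a < m × P ∣ U (suc (suc a)) - U (suc a)
    ratio-one = at-one (τ-onto (s≤s z≤n) 1<p)
      where
      at-one : (∃ λ a → a < m × τ a ≡ 1) → ∃ λ a → a < m × P ∣ U (suc (suc a)) - U (suc a)
      at-one (a , a<m , τₐ≡1) = a , a<m ,
        subst (λ t → P ∣ U (suc (suc a)) - t) (ZP.*-identityˡ (U (suc a)))
          (subst (λ t → P ∣ U (suc (suc a)) - + t * U (suc a)) τₐ≡1 (proj₂ (τ-ok a<m)))

    -- The ratio -1 ≡ p - 1 occurs: U (b+2) ≡ -U (b+1) (mod p).
    ratio-minus-one : ∃ λ b → b < m × P ∣ U (suc (suc b)) + U (suc b)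
    ratio-minus-one = at-minus-one
      (τ-onto (pred-< (s≤s z≤n) 1<p)
              (subst (m <_) (suc-pred p) (n<1+n m)))
      where
      add-p : ∀ x y q → x - q * y + (+ 1 + q) * y ≡ x + y
      add-p = solve-∀
      at-minus-one : (∃ λ b → b < m × τ b ≡ m) → ∃ λ b → b < m × P ∣ U (suc (suc b)) + U (suc b)
      at-minus-one (b , b<m , τᵦ≡m) = b , b<m ,
        subst (P ∣_) (add-p (U (suc (suc b))) (U (suc b)) (+ m))
          (∣m∣n⇒∣m+n (subst (λ t → P ∣ U (suc (suc b)) - + t * U (suc b)) τᵦ≡m (proj₂ (τ-ok b<m)))
                      (∣m⇒∣m*n (U (suc b)) (subst (P ∣_) (cong +_ (sym (suc-pred p))) ∣-refl)))

    -- A ratio 1 at a and a ratio -1 at b give zeros at 2a+3 and 2b+3.  Both are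
    -- multiples of the rank ρ > p below 2ρ, hence a = b and p ∣ 2 U (a+1).
    clash : ∀ {a b} → a < m → b < m → P ∣ U (suc (suc a)) - U (suc a) → P ∣ U (suc (suc b)) + U (suc b) → ⊥
    clash {a} {b} a<m b<m p∣U₂-U₁ p∣U₂+U₁ =
      [ ∤-between (s≤s z≤n) p-odd , no-zero (<-trans (n<1+n a) (n<m⇒suc-n<p a<m)) ]′ (euclid (+ 2) (U (suc a)) p∣2U₁)
      where
      zero-at-a : P ∣ U (suc (suc a ℕ.+ suc a))
      zero-at-a = subst (P ∣_) (sym (doubling (suc a))) (∣m⇒∣m*n (U (suc (suc a)) + U (suc a)) p∣U₂-U₁)
      zero-at-b : P ∣ U (suc (suc b ℕ.+ suc b))
      zero-at-b = subst (P ∣_) (sym (doubling (suc b))) (∣n⇒∣m*n (U (suc (suc b)) - U (suc b)) p∣U₂+U₁)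
      same-index : ∀ {N} → (∃ λ ρ0 → ρ0 < N × FirstZero ρ0) → a ≡ b
      same-index (ρ0 , _ , first) = suc-injective (double-injective (suc-injective
        (trans (index-is-rank a<m zero-at-a) (sym (index-is-rank b<m zero-at-b)))))
        where
        open Rank ρ0 first
        p≤ρ0 : p ≤ ρ0
        p≤ρ0 = ≮⇒≥ (λ ρ0<p → no-zero ρ0<p (proj₁ first))
        -- 2c+3 is a multiple of ρ in [1, 2ρ), hence equal to ρ.
        index-is-rank : ∀ {c} → c < m → P ∣ U (suc (suc c ℕ.+ suc c)) → suc (suc c ℕ.+ suc c) ≡ ρ
        index-is-rank c<m z = multiple-below-double (rank-divides _ z) (s≤s z≤n)
          (double-bound (≤-trans (<⇒≤ (n<m⇒suc-n<p c<m)) p≤ρ0))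
      a≡b : a ≡ b
      a≡b = same-index (least-below (λ n → P ∣? U (suc n)) _ (suc a ℕ.+ suc a , n<1+n _ , zero-at-a))
      p∣2U₁ : P ∣ + 2 * U (suc a)
      p∣2U₁ = subst (P ∣_) (difference (U (suc (suc a))) (U (suc a)))
        (∣m∣n⇒∣m-n (subst (λ c → P ∣ U (suc (suc c)) + U (suc c)) (sym a≡b) p∣U₂+U₁) p∣U₂-U₁)
        where
        difference : ∀ x y → (x + y) - (x - y) ≡ + 2 * y
        difference = solve-∀

    absurd : ⊥
    absurd = clash (proj₁ (proj₂ ratio-one)) (proj₁ (proj₂ ratio-minus-one))
                   (proj₂ (proj₂ ratio-one)) (proj₂ (proj₂ ratio-minus-one))

  rank-exists : 3 ≤ p → ∃ λ ρ0 → ρ0 < p × FirstZero ρ0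
  rank-exists p-odd with anyUpTo? (λ n → P ∣? U (suc n)) p
  ... | yes early = least-below (λ n → P ∣? U (suc n)) p early
  ... | no none = ⊥-elim (WithoutEarlyZero.absurd p-odd (λ n<p p∣ → none (_ , n<p , p∣)))

  module Formula (p-odd : 3 ≤ p) (ρ0 : ℕ) (first : FirstZero ρ0) (e : ℕ) (Uρ-exact : Exact e (U (suc ρ0))) where
    open Rank ρ0 first

    -- For n = p^b k ρ with p ∤ k, both U n and p^e n / ρ = p^(e+b) k are exactly
    -- divisible by p^(e+b).
    at-multiple : ∀ b k → ¬ p ∣ℕ k →
      νp p (ratio (U (p ^ b ℕ.* k ℕ.* ρ)) 1) ≡ νp p (ratio (+ (p ^ e) * + (p ^ b ℕ.* k ℕ.* ρ)) ρ)
    at-multiple b k p∤k =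
      trans (νp-integer (sym (ZP.*-identityʳ (U (p ^ b ℕ.* k ℕ.* ρ))))
                        (lifting {M = ρ} (s≤s z≤n) (odd-prime∣C[p,2] p-prime p-odd) (proj₁ first) Uρ-exact b k p∤k))
            (sym (νp-integer pᵉn≡ pᵉq-exact))
      where
      q = p ^ b ℕ.* k
      pᵉn≡ : + (p ^ e) * + (q ℕ.* ρ) ≡ + (p ^ e ℕ.* q) * + ρ
      pᵉn≡ = trans (sym (pos-* (p ^ e) (q ℕ.* ρ)))
               (trans (cong +_ (sym (*-assoc (p ^ e) q ρ))) (pos-* (p ^ e ℕ.* q) ρ))
      pᵉq-exact : Exact (e ℕ.+ b) (+ (p ^ e ℕ.* q))
      pᵉq-exact = exact-ℕ (trans (sym (*-assoc (p ^ e) (p ^ b) k))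
                                 (cong (ℕ._* k) (sym (^-distribˡ-+-* p e b)))) p∤k

    valuation : ∀ r n → 1 ≤ n → νd p r (ratio (U n) 1) ≡ δ ρ n * νd p r (ratio (+ (p ^ e) * + n) ρ)
    valuation r n 0<n with ρ ∣ℕ? n
    ... | no ρ∤n = trans (νd-zero p r (νp-integer (sym (ZP.*-identityʳ (U n))) (exact-unit p∤Uₙ)))
                         (sym (ZP.*-zeroˡ (νd p r (ratio (+ (p ^ e) * + n) ρ))))
      where
      p∤Uₙ : ¬ P ∣ U n
      p∤Uₙ p∣Uₙ = ρ∤n (rank-divides n p∣Uₙ)
    ... | yes (divides q refl) with p-adic q (positive-factor refl 0<n)
    ...   | b , k , refl , p∤k = trans (νd-congruent p r (at-multiple b k p∤k)) (sym (ZP.*-identityˡ _))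

module Main (t p : ℕ) (p-prime : Prime p) (p-odd : 3 ≤ p) where
  open Lucas (+ suc (suc t))
  open Valuation p p-prime
  open LucasModPrime (+ suc (suc t)) p p-prime

  rank : ∃ λ ρ0 → ρ0 < p × FirstZero ρ0
  rank = rank-exists p-odd

  ρ : ℕ
  ρ = suc (proj₁ rank)

  ρ≤p : ρ ≤ p
  ρ≤p = proj₁ (proj₂ rank)

  exponent : ∃ λ e → Exact e (U ρ)
  exponent = exact-of-positive (Positivity.positive t (proj₁ rank))

  e : ℕ
  e = proj₁ exponent

  open Formula p-odd (proj₁ rank) (proj₂ (proj₂ rank)) e (proj₂ exponent) public using (valuation)

theorem13 : (s : ℤ) → + 2 ℤ.≤ s → (p r : ℕ) → Prime p → 3 ≤ p → 1 ≤ r →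
    Σ ℤ λ s' → Σ ℕ λ d' → s' ≢ + 0 × 1 ≤ d' × d' ≤ p ^ r ×
      ((n : ℕ) → 1 ≤ n →
        νd p r (ratio (fib s -[1+ 0 ] n) 1)
          ≡ δ d' n ℤ.* νd p r (ratio (s' ℤ.* + n) d'))
theorem13 (+ suc (suc t)) (ℤ.+≤+ (s≤s (s≤s z≤n))) p r p-prime p-odd 1≤r =
  + (p ^ e) , ρ , pᵉ≢0 , s≤s z≤n , ρ≤pʳ , valuation r
  where
  open Main t p p-prime p-odd
  pᵉ≢0 : + (p ^ e) ≢ + 0
  pᵉ≢0 eq = ℕ.≢-nonZero⁻¹ (p ^ e) {{m^n≢0 p e {{prime⇒nonZero p-prime}}}} (ZP.+-injective eq)
  ρ≤pʳ : ρ ≤ p ^ r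
  ρ≤pʳ = ≤-trans ρ≤p (subst (_≤ p ^ r) (^-identityʳ p) (^-monoʳ-≤ p {{prime⇒nonZero p-prime}} 1≤r))
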